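{- Let $\mathcal{M}=\mathcal{M}(G;U,\rho,\tau)$ and $\widehat{\mathcal{M}}=\mathcal{M}(G;W,\hat\rho,\hat\tau)$ be two algebraic maps with the same group $G$. Then $\mathcal{M}\cong\widehat{\mathcal{M}}$ if and only if there exists an automorphism $\sigma\in\mathrm{Aut}(G)$ such that, for some $y\in G$, \[U^\sigma=y^{ -1}Wy,\qquad \rho^\sigma=\hat\rho,\qquad \tau^\sigma=\hat\tau.\]
   Context: An algebraic map $\mathcal{M}(G;U,\rho,\tau)$ consists of a group $G=\langle\rho,\tau\rangle$ with $\tau^2=1$ and a subgroup $U\le G$ such that the permutation representation of $G$ on the set $[G:U]$ of right cosets of $U$ (given by $(Ux)^a=Uxa$) is faithful. Two such maps $\mathcal{M}(G;U,\rho,\tau)$ and $\mathcal{M}(\widetilde G;\widetilde U,\widetilde\rho,\widetilde\tau)$ are isomorphic if there is a bijection $\mu:[G:U]\to[\widetilde G:\widetilde U]$ such that $(Ux)^{\mu\widetilde\rho}=(Ux)^{\rho\mu}$ and $(Ux)^{\mu\widetilde\tau}=(Ux)^{\tau\mu}$ for all $x\in G$ (maps composed left to right). -}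

module Defs where

open import Level using (Level; _⊔_; suc)
open import Algebra.Bundles using (Group)
open import Algebra.Morphism.Structures using (module GroupMorphisms)
open import Data.Product using (Σ; ∃; _×_; _,_)
open import Function.Bundles using (_⇔_)

module _ {c ℓ : Level} (G : Group c ℓ) where
  open Group G

  record IsSubgroup {p : Level} (U : Carrier → Set p) : Set (c ⊔ ℓ ⊔ p) where
    field
      resp    : ∀ {x y} → x ≈ y → U x → U y
      ε-mem   : U ε
      ∙-mem   : ∀ {x y} → U x → U y → U (x ∙ y)
      ⁻¹-mem  : ∀ {x} → U x → U (x ⁻¹)

  data InGen (ρ τ : Carrier) : Carrier → Set (c ⊔ ℓ) where
    gen-ρ : InGen ρ τ ρ
    gen-τ : InGen ρ τ τ
    gen-ε : InGen ρ τ ε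
    gen-∙ : ∀ {x y} → InGen ρ τ x → InGen ρ τ y → InGen ρ τ (x ∙ y)
    gen-⁻¹ : ∀ {x} → InGen ρ τ x → InGen ρ τ (x ⁻¹)
    gen-≈ : ∀ {x y} → x ≈ y → InGen ρ τ x → InGen ρ τ y

  -- Right cosets: Ux = Uy  iff  x y⁻¹ ∈ U.
  SameCoset : {p : Level} → (Carrier → Set p) → Carrier → Carrier → Set p
  SameCoset U x y = U (x ∙ y ⁻¹)

  -- Faithfulness of the action of G on [G:U], (Ux)^a = Uxa.
  Faithful : {p : Level} → (Carrier → Set p) → Set (c ⊔ ℓ ⊔ p)
  Faithful U = ∀ a → (∀ x → SameCoset U (x ∙ a) x) → a ≈ ε

  record IsAlgebraicMap {p : Level} (U : Carrier → Set p) (ρ τ : Carrier)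
         : Set (c ⊔ ℓ ⊔ p) where
    field
      subgroup   : IsSubgroup U
      generated  : ∀ g → InGen ρ τ g
      τ-involution : τ ∙ τ ≈ ε
      faithful   : Faithful U

  -- An isomorphism of maps M(G;U,ρ,τ) ≅ M(G;W,ρ̂,τ̂): a bijection
  -- μ : [G:U] → [G:W], represented on coset representatives by f,
  -- commuting with the actions of ρ/ρ̂ and τ/τ̂.
  record IsMapIsomorphism {p : Level} (U W : Carrier → Set p)
         (ρ τ ρ̂ τ̂ : Carrier) (f : Carrier → Carrier) : Set (c ⊔ p) where
    field
      well-defined : ∀ x y → SameCoset U x y → SameCoset W (f x) (f y)
      injective    : ∀ x y → SameCoset W (f x) (f y) → SameCoset U x y
      surjective   : ∀ z → ∃ λ x → SameCoset W (f x) z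
      comm-ρ       : ∀ x → SameCoset W (f x ∙ ρ̂) (f (x ∙ ρ))
      comm-τ       : ∀ x → SameCoset W (f x ∙ τ̂) (f (x ∙ τ))

  MapIsomorphic : {p : Level} (U W : Carrier → Set p) (ρ τ ρ̂ τ̂ : Carrier) → Set (c ⊔ p)
  MapIsomorphic U W ρ τ ρ̂ τ̂ = ∃ λ f → IsMapIsomorphism U W ρ τ ρ̂ τ̂ f

  IsAutomorphism : (Carrier → Carrier) → Set (c ⊔ ℓ)
  IsAutomorphism σ = GroupMorphisms.IsGroupIsomorphism rawGroup rawGroup σ

  ImageEqConj : {p : Level} (U W : Carrier → Set p) (σ : Carrier → Carrier) (y : Carrier)
              → Set (c ⊔ ℓ ⊔ p)
  ImageEqConj U W σ y =
    ∀ h → (∃ λ u → U u × σ u ≈ h) ⇔ (∃ λ w → W w × h ≈ y ⁻¹ ∙ w ∙ y)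

-- An isomorphism of maps is a bijection μ : [G:U] → [G:W] intertwining the
-- actions of ρ, τ with those of ρ̂, τ̂.  As G = ⟨ρ, τ⟩, μ then intertwines every
-- word w(ρ, τ) with w(ρ̂, τ̂), and faithfulness on [G:W] makes the substitution
-- w(ρ, τ) ↦ w(ρ̂, τ̂) a well-defined homomorphism σ; it is injective by
-- faithfulness on [G:U] and surjective since G = ⟨ρ̂, τ̂⟩.  Writing μ(U) = Wy,
-- one gets μ(Ux) = W y σ(x), and comparing the stabilisers of U and Wy gives
-- U^σ = y⁻¹ W y.  Conversely x ↦ y σ(x) induces an isomorphism of the maps.
module Submission where

open import Defs
open import Level using (Level)
open import Algebra.Bundles using (Group)
open import Algebra.Morphism.Structures using (module GroupMorphisms)
open import Data.Product using (∃; _×_; _,_)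
open import Function.Bundles using (_⇔_; mk⇔; module Equivalence)
import Algebra.Properties.Group as GroupProperties
import Relation.Binary.Reasoning.Setoid as SetoidReasoning

module GroupIdentities {c ℓ : Level} (G : Group c ℓ) where
  open Group G
  open GroupProperties G
  open SetoidReasoning setoid

  ∙-//-cancelʳ : ∀ a b d → (a ∙ d) // (b ∙ d) ≈ a // b
  ∙-//-cancelʳ a b d = begin
    (a ∙ d) ∙ (b ∙ d) ⁻¹      ≈⟨ ∙-congˡ (⁻¹-anti-homo-∙ b d) ⟩
    (a ∙ d) ∙ (d ⁻¹ ∙ b ⁻¹)   ≈⟨ assoc a d _ ⟩
    a ∙ (d ∙ (d ⁻¹ ∙ b ⁻¹))   ≈⟨ ∙-congˡ (\\-leftDividesˡ d (b ⁻¹)) ⟩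
    a ∙ b ⁻¹                  ∎

  //-chain : ∀ a b d → (a // b) ∙ (b // d) ≈ a // d
  //-chain a b d = begin
    (a ∙ b ⁻¹) ∙ (b ∙ d ⁻¹)   ≈⟨ assoc a _ _ ⟩
    a ∙ (b ⁻¹ ∙ (b ∙ d ⁻¹))   ≈⟨ ∙-congˡ (\\-leftDividesʳ b (d ⁻¹)) ⟩
    a ∙ d ⁻¹                  ∎

  ∙-//-conjugate : ∀ y a b → (y ∙ a) // (y ∙ b) ≈ y ∙ (a // b) ∙ y ⁻¹
  ∙-//-conjugate y a b = begin
    (y ∙ a) ∙ (y ∙ b) ⁻¹      ≈⟨ ∙-congˡ (⁻¹-anti-homo-∙ y b) ⟩
    (y ∙ a) ∙ (b ⁻¹ ∙ y ⁻¹)   ≈⟨ assoc _ _ _ ⟨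
    ((y ∙ a) ∙ b ⁻¹) ∙ y ⁻¹   ≈⟨ ∙-congʳ (assoc y a _) ⟩
    y ∙ (a ∙ b ⁻¹) ∙ y ⁻¹     ∎

  conjugate-cancel : ∀ y w → y ∙ (y ⁻¹ ∙ w ∙ y) ∙ y ⁻¹ ≈ w
  conjugate-cancel y w = begin
    y ∙ (y ⁻¹ ∙ w ∙ y) ∙ y ⁻¹     ≈⟨ ∙-congʳ (assoc y _ y) ⟨
    (y ∙ (y ⁻¹ ∙ w)) ∙ y ∙ y ⁻¹   ≈⟨ //-rightDividesʳ y _ ⟩
    y ∙ (y ⁻¹ ∙ w)                ≈⟨ \\-leftDividesˡ y w ⟩
    w                             ∎

  conjugate-cancel⁻¹ : ∀ y h → y ⁻¹ ∙ (y ∙ h ∙ y ⁻¹) ∙ y ≈ h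
  conjugate-cancel⁻¹ y h = begin
    y ⁻¹ ∙ (y ∙ h ∙ y ⁻¹) ∙ y     ≈⟨ ∙-congʳ (assoc _ _ (y ⁻¹)) ⟨
    (y ⁻¹ ∙ (y ∙ h)) ∙ y ⁻¹ ∙ y   ≈⟨ ∙-congʳ (∙-congʳ (\\-leftDividesʳ y h)) ⟩
    h ∙ y ⁻¹ ∙ y                  ≈⟨ //-rightDividesˡ y h ⟩
    h                             ∎

module RightCosets {c ℓ p : Level} (G : Group c ℓ)
  (S : Group.Carrier G → Set p) (subgroup : IsSubgroup G S) where
  open Group G
    using (Carrier; _≈_; _∙_; _⁻¹; _//_; ε; ∙-cong; ∙-congˡ; ⁻¹-cong; assoc; identityʳ)
    renaming (sym to ≈-sym; trans to ≈-trans)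
  open GroupProperties G
    using (x≈y⇒x∙y⁻¹≈ε; x∙y⁻¹≈ε⇒x≈y; ⁻¹-anti-homo-//; //-rightDividesʳ; ε⁻¹≈ε)
  open GroupIdentities G
  open IsSubgroup subgroup

  private
    _~_ : Carrier → Carrier → Set p
    _~_ = SameCoset G S

  resp₂ : ∀ {a a′ b b′} → a ≈ a′ → b ≈ b′ → a ~ b → a′ ~ b′
  resp₂ a≈a′ b≈b′ = resp (∙-cong a≈a′ (⁻¹-cong b≈b′))

  reflexive : ∀ {a b} → a ≈ b → a ~ b
  reflexive a≈b = resp (≈-sym (x≈y⇒x∙y⁻¹≈ε a≈b)) ε-mem

  sym : ∀ {a b} → a ~ b → b ~ a
  sym {a} {b} a~b = resp (⁻¹-anti-homo-// a b) (⁻¹-mem a~b)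

  trans : ∀ {a b d} → a ~ b → b ~ d → a ~ d
  trans {a} {b} {d} a~b b~d = resp (//-chain a b d) (∙-mem a~b b~d)

  ∙-congʳ : ∀ {a b} d → a ~ b → (a ∙ d) ~ (b ∙ d)
  ∙-congʳ {a} {b} d = resp (≈-sym (∙-//-cancelʳ a b d))

  ∙-cancelʳ : ∀ {a b} d → (a ∙ d) ~ (b ∙ d) → a ~ b
  ∙-cancelʳ {a} {b} d = resp (∙-//-cancelʳ a b d)

  private
    //ε≈ : ∀ a → a // ε ≈ a
    //ε≈ a = ≈-trans (∙-congˡ ε⁻¹≈ε) (identityʳ a)

  ∈⇒~ε : ∀ {a} → S a → a ~ ε
  ∈⇒~ε {a} = resp (≈-sym (//ε≈ a))

  ~ε⇒∈ : ∀ {a} → a ~ ε → S a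
  ~ε⇒∈ {a} = resp (//ε≈ a)

  -- Faithfulness, applied to a // b, says that the action separates points.
  faithful⇒cancelˡ : Faithful G S → ∀ {a b} → (∀ z → (z ∙ a) ~ (z ∙ b)) → a ≈ b
  faithful⇒cancelˡ faithful {a} {b} za~zb =
    x∙y⁻¹≈ε⇒x≈y a b (faithful (a // b) λ z →
      resp₂ (assoc z a (b ⁻¹)) (//-rightDividesʳ b z) (∙-congʳ (b ⁻¹) (za~zb z)))

module _ {c ℓ p : Level} (G : Group c ℓ) {U W : Group.Carrier G → Set p}
  (subgroupU : IsSubgroup G U) (subgroupW : IsSubgroup G W) where
  open Group G
  open GroupProperties G using (\\-leftDividesˡ)
  open GroupIdentities G
  open GroupMorphisms rawGroup rawGroup using (module IsGroupIsomorphism)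
  open SetoidReasoning setoid
  private
    module U = IsSubgroup subgroupU
    module W = IsSubgroup subgroupW
    module W~ = RightCosets G W subgroupW

  conjugation-isMapIsomorphism : ∀ {ρ τ ρ̂ τ̂ σ} → IsAutomorphism G σ → ∀ y
    → ImageEqConj G U W σ y → σ ρ ≈ ρ̂ → σ τ ≈ τ̂
    → IsMapIsomorphism G U W ρ τ ρ̂ τ̂ (λ x → y ∙ σ x)
  conjugation-isMapIsomorphism {σ = σ} aut y image≈conj σρ≈ρ̂ στ≈τ̂ = record
    { well-defined = well-defined
    ; injective    = injective
    ; surjective   = surjective
    ; comm-ρ       = intertwines σρ≈ρ̂
    ; comm-τ       = intertwines στ≈τ̂
    }
    where
    open IsGroupIsomorphism aut using (∙-homo; ⁻¹-homo)
      renaming (injective to σ-injective; surjective to σ-surjective)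
    open Equivalence using (to; from)

    conjugate-σ-// : ∀ x x′ → (y ∙ σ x) // (y ∙ σ x′) ≈ y ∙ σ (x // x′) ∙ y ⁻¹
    conjugate-σ-// x x′ = begin
      (y ∙ σ x) // (y ∙ σ x′)      ≈⟨ ∙-//-conjugate y (σ x) (σ x′) ⟩
      y ∙ (σ x // σ x′) ∙ y ⁻¹     ≈⟨ ∙-congʳ (∙-congˡ (∙-congˡ (⁻¹-homo x′))) ⟨
      y ∙ (σ x ∙ σ (x′ ⁻¹)) ∙ y ⁻¹ ≈⟨ ∙-congʳ (∙-congˡ (∙-homo x (x′ ⁻¹))) ⟨
      y ∙ σ (x // x′) ∙ y ⁻¹       ∎

    well-defined : ∀ x x′ → SameCoset G U x x′ → SameCoset G W (y ∙ σ x) (y ∙ σ x′)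
    well-defined x x′ Ux//x′ with to (image≈conj (σ (x // x′))) (x // x′ , Ux//x′ , refl)
    ... | w , Ww , σ[x//x′]≈w^y = W.resp (sym (begin
      (y ∙ σ x) // (y ∙ σ x′)     ≈⟨ conjugate-σ-// x x′ ⟩
      y ∙ σ (x // x′) ∙ y ⁻¹      ≈⟨ ∙-congʳ (∙-congˡ σ[x//x′]≈w^y) ⟩
      y ∙ (y ⁻¹ ∙ w ∙ y) ∙ y ⁻¹   ≈⟨ conjugate-cancel y w ⟩
      w                           ∎)) Ww

    injective : ∀ x x′ → SameCoset G W (y ∙ σ x) (y ∙ σ x′) → SameCoset G U x x′
    injective x x′ W[yσx//yσx′]
      with from (image≈conj (σ (x // x′))) (_ , W[yσx//yσx′] , (begin
      σ (x // x′)                            ≈⟨ conjugate-cancel⁻¹ y _ ⟨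
      y ⁻¹ ∙ (y ∙ σ (x // x′) ∙ y ⁻¹) ∙ y    ≈⟨ ∙-congʳ (∙-congˡ (conjugate-σ-// x x′)) ⟨
      y ⁻¹ ∙ ((y ∙ σ x) // (y ∙ σ x′)) ∙ y   ∎))
    ... | u , Uu , σu≈σ[x//x′] = U.resp (σ-injective σu≈σ[x//x′]) Uu

    surjective : ∀ z → ∃ λ x → SameCoset G W (y ∙ σ x) z
    surjective z with σ-surjective (y ⁻¹ ∙ z)
    ... | x , σx≈y⁻¹z = x , W~.reflexive (trans (∙-congˡ (σx≈y⁻¹z refl)) (\\-leftDividesˡ y z))

    intertwines : ∀ {r r̂} → σ r ≈ r̂ → ∀ x → SameCoset G W (y ∙ σ x ∙ r̂) (y ∙ σ (x ∙ r))
    intertwines {r} {r̂} σr≈r̂ x = W~.reflexive (begin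
      y ∙ σ x ∙ r̂         ≈⟨ assoc y (σ x) r̂ ⟩
      y ∙ (σ x ∙ r̂)       ≈⟨ ∙-congˡ (∙-congˡ σr≈r̂) ⟨
      y ∙ (σ x ∙ σ r)     ≈⟨ ∙-congˡ (∙-homo x r) ⟨
      y ∙ σ (x ∙ r)       ∎)

module _ {c ℓ : Level} (G : Group c ℓ) where
  open Group G

  -- A derivation of InGen G r t g is a word in r, t representing g; evalWord a b
  -- substitutes a for r and b for t in it.
  evalWord : ∀ {r t g} → Carrier → Carrier → InGen G r t g → Carrier
  evalWord a b gen-ρ        = a
  evalWord a b gen-τ        = b
  evalWord a b gen-ε        = ε
  evalWord a b (gen-∙ v w)  = evalWord a b v ∙ evalWord a b w
  evalWord a b (gen-⁻¹ w)   = evalWord a b w ⁻¹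
  evalWord a b (gen-≈ _ w)  = evalWord a b w

module InducedAutomorphism {c ℓ p : Level} (G : Group c ℓ)
  {U W : Group.Carrier G → Set p} {ρ τ ρ̂ τ̂ : Group.Carrier G}
  (mapU : IsAlgebraicMap G U ρ τ) (mapW : IsAlgebraicMap G W ρ̂ τ̂)
  {μ : Group.Carrier G → Group.Carrier G} (iso : IsMapIsomorphism G U W ρ τ ρ̂ τ̂ μ) where
  open Group G
  open GroupProperties G using (//-rightDividesˡ)
  open SetoidReasoning setoid
  open GroupIdentities G
  open IsMapIsomorphism iso
  private
    module U = IsAlgebraicMap mapU
    module W = IsAlgebraicMap mapW
    module U~ = RightCosets G U U.subgroup
    module W~ = RightCosets G W W.subgroup
    open IsSubgroup W.subgroup using () renaming (resp to W-resp)

  μ-cong : ∀ {a b} → a ≈ b → SameCoset G W (μ a) (μ b)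
  μ-cong a≈b = well-defined _ _ (U~.reflexive a≈b)

  μ-intertwines-word : ∀ {g} (w : InGen G ρ τ g) x
    → SameCoset G W (μ x ∙ evalWord G ρ̂ τ̂ w) (μ (x ∙ g))
  μ-intertwines-word gen-ρ x = comm-ρ x
  μ-intertwines-word gen-τ x = comm-τ x
  μ-intertwines-word gen-ε x =
    W~.trans (W~.reflexive (identityʳ (μ x))) (μ-cong (sym (identityʳ x)))
  μ-intertwines-word (gen-∙ {g₁} v w) x =
    W~.trans (W~.reflexive (sym (assoc _ _ _)))
      (W~.trans (W~.∙-congʳ _ (μ-intertwines-word v x))
        (W~.trans (μ-intertwines-word w (x ∙ g₁)) (μ-cong (assoc _ _ _))))
  μ-intertwines-word (gen-⁻¹ {g} w) x = W~.sym (W~.∙-cancelʳ (evalWord G ρ̂ τ̂ w)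
    (W~.trans (μ-intertwines-word w (x ∙ g ⁻¹))
      (W~.trans (μ-cong (//-rightDividesˡ g x))
        (W~.reflexive (sym (//-rightDividesˡ _ (μ x)))))))
  μ-intertwines-word (gen-≈ g≈h w) x =
    W~.trans (μ-intertwines-word w x) (μ-cong (∙-congˡ g≈h))

  -- Two words for the same element act alike on μ([G:U]) = [G:W], so faithfulness
  -- on [G:W] identifies their values at ρ̂, τ̂.
  evalWord-cong : ∀ {g₁ g₂} (w₁ : InGen G ρ τ g₁) (w₂ : InGen G ρ τ g₂) → g₁ ≈ g₂
    → evalWord G ρ̂ τ̂ w₁ ≈ evalWord G ρ̂ τ̂ w₂
  evalWord-cong w₁ w₂ g₁≈g₂ = W~.faithful⇒cancelˡ W.faithful λ z →
    let (x , μx~z) = surjective z in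
    W~.trans (W~.∙-congʳ _ (W~.sym μx~z))
      (W~.trans (μ-intertwines-word w₁ x)
        (W~.trans (μ-cong (∙-congˡ g₁≈g₂))
          (W~.trans (W~.sym (μ-intertwines-word w₂ x)) (W~.∙-congʳ _ μx~z))))

  σ : Carrier → Carrier
  σ g = evalWord G ρ̂ τ̂ (U.generated g)

  σ-cong : ∀ {g h} → g ≈ h → σ g ≈ σ h
  σ-cong = evalWord-cong (U.generated _) (U.generated _)

  σ-∙-homo : ∀ g h → σ (g ∙ h) ≈ σ g ∙ σ h
  σ-∙-homo g h = evalWord-cong (U.generated _) (gen-∙ (U.generated g) (U.generated h)) refl

  σ-ε-homo : σ ε ≈ ε
  σ-ε-homo = evalWord-cong (U.generated ε) gen-ε refl

  σ-⁻¹-homo : ∀ g → σ (g ⁻¹) ≈ σ g ⁻¹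
  σ-⁻¹-homo g = evalWord-cong (U.generated _) (gen-⁻¹ (U.generated g)) refl

  σρ≈ρ̂ : σ ρ ≈ ρ̂
  σρ≈ρ̂ = evalWord-cong (U.generated ρ) gen-ρ refl

  στ≈τ̂ : σ τ ≈ τ̂
  στ≈τ̂ = evalWord-cong (U.generated τ) gen-τ refl

  σ-intertwines : ∀ x g → SameCoset G W (μ x ∙ σ g) (μ (x ∙ g))
  σ-intertwines x g = μ-intertwines-word (U.generated g) x

  σ-evalWord : ∀ {h} (w : InGen G ρ̂ τ̂ h) → σ (evalWord G ρ τ w) ≈ h
  σ-evalWord gen-ρ         = σρ≈ρ̂
  σ-evalWord gen-τ         = στ≈τ̂
  σ-evalWord gen-ε         = σ-ε-homo
  σ-evalWord (gen-∙ v w)   = trans (σ-∙-homo _ _) (∙-cong (σ-evalWord v) (σ-evalWord w))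
  σ-evalWord (gen-⁻¹ w)    = trans (σ-⁻¹-homo _) (⁻¹-cong (σ-evalWord w))
  σ-evalWord (gen-≈ e w)   = trans (σ-evalWord w) e

  σ-injective : ∀ {g h} → σ g ≈ σ h → g ≈ h
  σ-injective {g} {h} σg≈σh = U~.faithful⇒cancelˡ U.faithful λ z →
    injective (z ∙ g) (z ∙ h)
      (W~.trans (W~.sym (σ-intertwines z g))
        (W~.trans (W~.reflexive (∙-congˡ σg≈σh)) (σ-intertwines z h)))

  σ-surjective : ∀ h → ∃ λ g → ∀ {z} → z ≈ g → σ z ≈ h
  σ-surjective h = evalWord G ρ τ (W.generated h) ,
    λ z≈g → trans (σ-cong z≈g) (σ-evalWord (W.generated h))

  σ-isAutomorphism : IsAutomorphism G σ
  σ-isAutomorphism = record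
    { isGroupMonomorphism = record
      { isGroupHomomorphism = record
        { isMonoidHomomorphism = record
          { isMagmaHomomorphism = record
            { isRelHomomorphism = record { cong = σ-cong }
            ; homo = σ-∙-homo }
          ; ε-homo = σ-ε-homo }
        ; ⁻¹-homo = σ-⁻¹-homo }
      ; injective = σ-injective }
    ; surjective = σ-surjective }

  -- y represents the image μ(U) = W y of the base coset.
  y : Carrier
  y = μ ε

  μ~yσ : ∀ g → SameCoset G W (μ g) (y ∙ σ g)
  μ~yσ g = W~.sym (W~.trans (σ-intertwines ε g) (μ-cong (identityˡ g)))

  σ[U]≈W^y : ImageEqConj G U W σ y
  σ[U]≈W^y h = mk⇔ image⇒conjugate conjugate⇒image
    where
    image⇒conjugate : (∃ λ u → U u × σ u ≈ h) → ∃ λ w → W w × h ≈ y ⁻¹ ∙ w ∙ y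
    image⇒conjugate (u , Uu , σu≈h) =
      y ∙ h ∙ y ⁻¹ ,
      W-resp (∙-congʳ (∙-congˡ σu≈h))
        (W~.trans (W~.sym (μ~yσ u)) (well-defined u ε (U~.∈⇒~ε Uu))) ,
      sym (conjugate-cancel⁻¹ y h)

    conjugate⇒image : (∃ λ w → W w × h ≈ y ⁻¹ ∙ w ∙ y) → ∃ λ u → U u × σ u ≈ h
    conjugate⇒image (w , Ww , h≈w^y) =
      let (u , σ[≈u]≈h) = σ-surjective h in
      u ,
      U~.~ε⇒∈ (injective u ε (W~.trans (μ~yσ u)
        (W-resp (sym (begin
          y ∙ σ u ∙ y ⁻¹            ≈⟨ ∙-congʳ (∙-congˡ (trans (σ[≈u]≈h refl) h≈w^y)) ⟩
          y ∙ (y ⁻¹ ∙ w ∙ y) ∙ y ⁻¹ ≈⟨ conjugate-cancel y w ⟩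
          w                         ∎)) Ww))) ,
      σ[≈u]≈h refl

corollary5p3 : {c ℓ p : Level} (G : Group c ℓ)
    (U W : Group.Carrier G → Set p) (ρ τ ρ̂ τ̂ : Group.Carrier G)
    → IsAlgebraicMap G U ρ τ
    → IsAlgebraicMap G W ρ̂ τ̂
    → MapIsomorphic G U W ρ τ ρ̂ τ̂
      ⇔ (∃ λ σ → IsAutomorphism G σ × (∃ λ y → ImageEqConj G U W σ y
            × Group._≈_ G (σ ρ) ρ̂ × Group._≈_ G (σ τ) τ̂))
corollary5p3 G U W ρ τ ρ̂ τ̂ mapU mapW = mk⇔
  (λ { (μ , iso) → let open InducedAutomorphism G mapU mapW iso in
         σ , σ-isAutomorphism , y , σ[U]≈W^y , σρ≈ρ̂ , στ≈τ̂ })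
  (λ { (σ , aut , y , image≈conj , σρ≈ρ̂ , στ≈τ̂) →
         _ , conjugation-isMapIsomorphism G (IsAlgebraicMap.subgroup mapU)
               (IsAlgebraicMap.subgroup mapW) aut y image≈conj σρ≈ρ̂ στ≈τ̂ })
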